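{- Let $k, d$ be positive integers with $d$ odd. Then $\chi'_d(Sh(k)) = \lceil\frac{3k-1}{3d-1}\rceil$.
   Context: Graphs are finite, undirected, without loops, but may have multiple edges. For an integer $k$, the Shannon graph $Sh(k)$ is the graph on three vertices whose three pairs of vertices are joined by $\lfloor \frac{k}{2} \rfloor$, $\lfloor \frac{k}{2} \rfloor$ and $\lceil \frac{k}{2} \rceil$ parallel edges respectively. An edge colouring of $G$ with defect $d$ is a colouring of $E(G)$ such that each vertex is incident with at most $d$ edges of the same colour; $\chi'_d(G)$ is the minimum number of colours in an edge colouring of $G$ with defect $d$. -}

module Defs where

open import Data.Nat using (ℕ; zero; suc; _+_; _*_; _∸_; _≤_; ⌊_/2⌋; ⌈_/2⌉)
open import Data.Nat.DivMod using (_/_)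
open import Data.Fin using (Fin; zero; suc; splitAt; _≟_)
open import Data.List using (List; length; filter; allFin)
open import Data.Product using (Σ; _×_; _,_; proj₁; proj₂)
open import Data.Sum using (_⊎_; inj₁; inj₂)
open import Relation.Binary.PropositionalEquality using (_≡_)
open import Relation.Nullary using (¬_)
open import Relation.Nullary.Decidable using (_×-dec_; _⊎-dec_)

-- A finite loopless multigraph: vertices Fin nV, edges Fin nE (distinct
-- edges may have the same endpoints, so parallel edges are allowed).
record Multigraph : Set where
  field
    nV     : ℕ
    nE     : ℕ
    ends   : Fin nE → Fin nV × Fin nV
    noLoop : ∀ e → ¬ (proj₁ (ends e) ≡ proj₂ (ends e))
open Multigraph public

colourDegree : (G : Multigraph) {c : ℕ} → (Fin (nE G) → Fin c) → Fin (nV G) → Fin c → ℕ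
colourDegree G col v a =
  length (filter (λ e → ((v ≟ proj₁ (ends G e)) ⊎-dec (v ≟ proj₂ (ends G e))) ×-dec (col e ≟ a))
                 (allFin (nE G)))

IsDefectColouring : (G : Multigraph) (d c : ℕ) → (Fin (nE G) → Fin c) → Set
IsDefectColouring G d c col = ∀ v a → colourDegree G col v a ≤ d

HasDefectColouring : (G : Multigraph) (d c : ℕ) → Set
HasDefectColouring G d c = Σ (Fin (nE G) → Fin c) (IsDefectColouring G d c)

ChiD≡ : (G : Multigraph) (d N : ℕ) → Set
ChiD≡ G d N = HasDefectColouring G d N × (∀ c → HasDefectColouring G d c → N ≤ c)

-- Shannon graph Sh(k) on vertices 0,1,2: pairs {0,1},{1,2} get ⌊k/2⌋ parallel
-- edges, pair {0,2} gets ⌈k/2⌉ parallel edges.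
private
  v0 v1 v2 : Fin 3
  v0 = zero
  v1 = suc zero
  v2 = suc (suc zero)

  shEnds : (k : ℕ) → Fin (⌊ k /2⌋ + (⌊ k /2⌋ + ⌈ k /2⌉)) → Fin 3 × Fin 3
  shEnds k e with splitAt ⌊ k /2⌋ e
  ... | inj₁ _ = v0 , v1
  ... | inj₂ e' with splitAt ⌊ k /2⌋ e'
  ...   | inj₁ _ = v1 , v2
  ...   | inj₂ _ = v0 , v2

  shNoLoop : (k : ℕ) → ∀ e → ¬ (proj₁ (shEnds k e) ≡ proj₂ (shEnds k e))
  shNoLoop k e with splitAt ⌊ k /2⌋ e
  ... | inj₁ _ = λ ()
  ... | inj₂ e' with splitAt ⌊ k /2⌋ e'
  ...   | inj₁ _ = λ ()
  ...   | inj₂ _ = λ ()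

Sh : ℕ → Multigraph
Sh k = record
  { nV = 3
  ; nE = ⌊ k /2⌋ + (⌊ k /2⌋ + ⌈ k /2⌉)
  ; ends = shEnds k
  ; noLoop = shNoLoop k
  }

-- ceiling division ⌈a / b⌉ (for b > 0; value 0 for b = 0, never used)
⌈_/_⌉ : ℕ → ℕ → ℕ
⌈ a / zero ⌉ = zero
⌈ a / suc b ⌉ = (a + b) / suc b

{-# OPTIONS --safe #-}
-- Write d = 2h + 1 and W = 3h + 1, so that 3d − 1 = 2W.
-- Lower bound: the degrees in one colour class sum to twice its size and are each at most d,
-- so on three vertices a class has at most ⌊3d/2⌋ = W edges; as Sh(k) has at least (3k − 1)/2
-- edges, at least (3k − 1)/(2W) colours are needed.
-- Upper bound: place the edges of Sh(k) on distinct slots 0, 1, 2, … going round the triangle,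
-- so that the edges at a vertex are exactly those whose slot avoids one residue mod 3, and give
-- slot x the colour ⌊x/W⌋.  Any W = 3h + 1 consecutive integers contain at most 2h + 1 = d
-- avoiding a fixed residue, and the fewer than W⌈(3k − 1)/(2W)⌉ slots need only that many colours.
module Submission where

open import Defs
open import Data.Nat using (ℕ; zero; suc; _+_; _*_; _∸_; _≤_; _<_; z≤n; s≤s; s≤s⁻¹; _%_; ⌊_/2⌋; ⌈_/2⌉)
open import Data.Nat.Properties
open import Data.Nat.DivMod using (_/_; /-congˡ; m*n/n≡m; /-monoˡ-≤; +-distrib-/-∣ʳ; m≡m%n+[m/n]*n; m%n<n; m<n*o⇒m/o<n; [m+n]%n≡m%n; [m+kn]%n≡m%n)
open import Data.Fin as Fin using (Fin; zero; suc; toℕ; fromℕ<; splitAt; join; _↑ˡ_; _↑ʳ_; punchIn; punchOut; combine; quotient)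
open import Data.Fin.Properties using (toℕ-fromℕ<; fromℕ<-injective; toℕ<n; toℕ-injective; join-splitAt; punchOut-injective; punchIn-punchOut; remQuot-combine; toℕ-combine)
  renaming (suc-injective to Fin-suc-injective)
open import Data.List using (length; filter; tabulate)
open import Data.Bool using (true; false; if_then_else_)
open import Data.Product using (_,_; proj₁; proj₂)
open import Data.Sum using (_⊎_; inj₁; inj₂; map₂)
open import Function using (_∘_; case_of_; Injective)
open import Relation.Binary.PropositionalEquality
open import Relation.Nullary using (Dec; yes; no; ¬_; does; contradiction)
open import Relation.Nullary.Decidable using (_×-dec_; _⊎-dec_; ¬?)
open import Relation.Unary using (Decidable)
open import Data.Nat.Divisibility using (n∣m*n)
open import Data.Nat.Tactic.RingSolver using (solve-∀)
open import Algebra.Properties.CommutativeSemigroup +-commutativeSemigroup using (x∙yz≈y∙zx)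
open import Algebra.Properties.Semiring.Sum +-*-semiring
  using (sum; sum-syntax; ∑-comm; ∑-distrib-+; sum-cong-≗; sum-remove; *-distribˡ-sum; *-distribʳ-sum)

𝟙 : ∀ {p} {P : Set p} → Dec P → ℕ
𝟙 P? = if does P? then 1 else 0

𝟙≤1 : ∀ {p} {P : Set p} (P? : Dec P) → 𝟙 P? ≤ 1
𝟙≤1 (yes _) = ≤-refl
𝟙≤1 (no _)  = z≤n

𝟙-mono : ∀ {p q} {P : Set p} {Q : Set q} (P? : Dec P) (Q? : Dec Q) → (P → Q) → 𝟙 P? ≤ 𝟙 Q?
𝟙-mono (no _)  _       _   = z≤n
𝟙-mono (yes _) (yes _) _   = ≤-refl
𝟙-mono (yes p) (no ¬q) P→Q = contradiction (P→Q p) ¬q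

𝟙-× : ∀ {p q} {P : Set p} {Q : Set q} (P? : Dec P) (Q? : Dec Q) → 𝟙 (P? ×-dec Q?) ≡ 𝟙 P? * 𝟙 Q?
𝟙-× (yes _) (yes _) = refl
𝟙-× (yes _) (no _)  = refl
𝟙-× (no _)  _       = refl

𝟙-⊎ : ∀ {p q} {P : Set p} {Q : Set q} (P? : Dec P) (Q? : Dec Q) → (P → ¬ Q) →
      𝟙 (P? ⊎-dec Q?) ≡ 𝟙 P? + 𝟙 Q?
𝟙-⊎ (yes p) (yes q) P→¬Q = contradiction q (P→¬Q p)
𝟙-⊎ (yes _) (no _)  _    = refl
𝟙-⊎ (no _)  (yes _) _    = refl
𝟙-⊎ (no _)  (no _)  _    = refl

𝟙-≟-sym : ∀ {n} (i j : Fin n) → 𝟙 (i Fin.≟ j) ≡ 𝟙 (j Fin.≟ i)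
𝟙-≟-sym i j with i Fin.≟ j | j Fin.≟ i
... | yes _   | yes _   = refl
... | no _    | no _    = refl
... | yes i≡j | no j≢i  = contradiction (sym i≡j) j≢i
... | no i≢j  | yes j≡i = contradiction (sym j≡i) i≢j

length-filter-tabulate : ∀ {a p} {A : Set a} {P : A → Set p} (P? : Decidable P) {n} (f : Fin n → A) →
  length (filter P? (tabulate f)) ≡ ∑[ i < n ] 𝟙 (P? (f i))
length-filter-tabulate P? {zero}  f = refl
length-filter-tabulate P? {suc n} f with does (P? (f zero))
... | true  = cong suc (length-filter-tabulate P? (f ∘ suc))
... | false = length-filter-tabulate P? (f ∘ suc)

∑-mono-≤ : ∀ {n} {f g : Fin n → ℕ} → (∀ i → f i ≤ g i) → ∑[ i < n ] f i ≤ ∑[ i < n ] g i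
∑-mono-≤ {zero}  f≤g = z≤n
∑-mono-≤ {suc n} f≤g = +-mono-≤ (f≤g zero) (∑-mono-≤ (f≤g ∘ suc))

∑-const : ∀ n x → ∑[ i < n ] x ≡ n * x
∑-const zero    x = refl
∑-const (suc n) x = cong (x +_) (∑-const n x)

∑-δ : ∀ {n} (j : Fin n) (f : Fin n → ℕ) → ∑[ i < n ] (𝟙 (i Fin.≟ j) * f i) ≡ f j
∑-δ {suc n} zero    f = begin
  1 * f zero + ∑[ i < n ] 0              ≡⟨ cong₂ _+_ (*-identityˡ (f zero)) (∑-const n 0) ⟩
  f zero + n * 0                         ≡⟨ cong (f zero +_) (*-zeroʳ n) ⟩
  f zero + 0                             ≡⟨ +-identityʳ (f zero) ⟩
  f zero                                 ∎
  where open ≡-Reasoning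
∑-δ {suc n} (suc j) f = ∑-δ j (f ∘ suc)

∑-𝟙-≟ : ∀ {n} (j : Fin n) → ∑[ i < n ] 𝟙 (i Fin.≟ j) ≡ 1
∑-𝟙-≟ {n} j = trans (sum-cong-≗ {n} λ i → sym (*-identityʳ (𝟙 (i Fin.≟ j)))) (∑-δ j (λ _ → 1))

∑-↑ : ∀ p q (f : Fin (p + q) → ℕ) →
  ∑[ i < p + q ] f i ≡ ∑[ i < p ] f (i ↑ˡ q) + ∑[ j < q ] f (p ↑ʳ j)
∑-↑ zero    q f = refl
∑-↑ (suc p) q f = trans (cong (f zero +_) (∑-↑ p q (f ∘ suc))) (sym (+-assoc (f zero) _ _))

∑-combine : ∀ m n (f : Fin (m * n) → ℕ) → ∑[ y < m * n ] f y ≡ ∑[ i < m ] ∑[ t < n ] f (combine i t)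
∑-combine zero    n f = refl
∑-combine (suc m) n f = trans (∑-↑ n (m * n) f) (cong (∑[ t < n ] f (t ↑ˡ (m * n)) +_) (∑-combine m n (f ∘ (n ↑ʳ_))))

∑-injective-≤ : ∀ {m n} (φ : Fin m → Fin n) → Injective _≡_ _≡_ φ → (w : Fin n → ℕ) →
                ∑[ e < m ] w (φ e) ≤ ∑[ y < n ] w y
∑-injective-≤ {zero}          φ _   w = z≤n
∑-injective-≤ {suc m} {zero}  φ _   w with φ zero
... | ()
∑-injective-≤ {suc m} {suc n} φ inj w = begin
  w i + ∑[ e < m ] w (φ (suc e))                   ≡⟨ cong (w i +_) (sum-cong-≗ λ e → cong w (sym (punchIn-punchOut (i≢φsuc e)))) ⟩
  w i + ∑[ e < m ] w (punchIn i (φ′ e))            ≤⟨ +-monoʳ-≤ (w i) (∑-injective-≤ φ′ φ′-injective (w ∘ punchIn i)) ⟩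
  w i + ∑[ y < n ] w (punchIn i y)                 ≡⟨ sum-remove w ⟨
  ∑[ y < suc n ] w y                               ∎
  where
  open ≤-Reasoning
  i = φ zero
  i≢φsuc : ∀ e → i ≢ φ (suc e)
  i≢φsuc e eq with inj eq
  ... | ()
  φ′ : Fin m → Fin n
  φ′ e = punchOut (i≢φsuc e)
  φ′-injective : Injective _≡_ _≡_ φ′
  φ′-injective eq = Fin-suc-injective (inj (punchOut-injective (i≢φsuc _) (i≢φsuc _) eq))

⌈n/2⌉≤1+⌊n/2⌋ : ∀ n → ⌈ n /2⌉ ≤ suc ⌊ n /2⌋
⌈n/2⌉≤1+⌊n/2⌋ zero          = z≤n
⌈n/2⌉≤1+⌊n/2⌋ (suc zero)    = ≤-refl
⌈n/2⌉≤1+⌊n/2⌋ (suc (suc n)) = s≤s (⌈n/2⌉≤1+⌊n/2⌋ n)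

[1+n*2]/2≡n : ∀ n → (1 + n * 2) / 2 ≡ n
[1+n*2]/2≡n n = trans (+-distrib-/-∣ʳ 1 {d = 2} (n∣m*n n)) (m*n/n≡m n 2)

m*2≤1+n*2⇒m≤n : ∀ {m n} → m * 2 ≤ 1 + n * 2 → m ≤ n
m*2≤1+n*2⇒m≤n {m} {n} le = begin
  m                  ≡⟨ m*n/n≡m m 2 ⟨
  m * 2 / 2          ≤⟨ /-monoˡ-≤ 2 le ⟩
  (1 + n * 2) / 2    ≡⟨ [1+n*2]/2≡n n ⟩
  n                  ∎
  where open ≤-Reasoning

≤⌈/⌉* : ∀ x D → x ≤ ⌈ x / suc D ⌉ * suc D
≤⌈/⌉* x D = +-cancelʳ-≤ D x _ (begin
  x + D                                     ≡⟨ m≡m%n+[m/n]*n (x + D) (suc D) ⟩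
  (x + D) % suc D + (x + D) / suc D * suc D ≤⟨ +-monoˡ-≤ _ (s≤s⁻¹ (m%n<n (x + D) (suc D))) ⟩
  D + (x + D) / suc D * suc D               ≡⟨ +-comm D _ ⟩
  (x + D) / suc D * suc D + D               ∎)
  where open ≤-Reasoning

⌈/⌉-least : ∀ x D c → x ≤ c * suc D → ⌈ x / suc D ⌉ ≤ c
⌈/⌉-least x D c le = s≤s⁻¹ (m<n*o⇒m/o<n (begin-strict
  x + D             ≡⟨ +-comm x D ⟩
  D + x             <⟨ +-monoˡ-< x (n<1+n D) ⟩
  suc D + x         ≤⟨ +-monoʳ-≤ (suc D) le ⟩
  suc D + c * suc D ∎))
  where open ≤-Reasoning

3*[1+h*2]≡1+[1+h*3]*2 : ∀ h → 3 * suc (h * 2) ≡ 1 + suc (h * 3) * 2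
3*[1+h*2]≡1+[1+h*3]*2 = solve-∀

residue : ∀ r i → (r + i * 3) % 3 ≡ r % 3
residue r i = [m+kn]%n≡m%n r i 3

residue-≡ : ∀ r s i j → r + i * 3 ≡ s + j * 3 → r % 3 ≡ s % 3
residue-≡ r s i j eq = trans (sym (residue r i)) (trans (cong (_% 3) eq) (residue s j))

r+toℕ*3-injective : ∀ {n} r {i j : Fin n} → r + toℕ i * 3 ≡ r + toℕ j * 3 → i ≡ j
r+toℕ*3-injective r eq = toℕ-injective (*-cancelʳ-≡ _ _ 3 (+-cancelˡ-≡ r _ _ eq))

Incident : (G : Multigraph) → Fin (nV G) → Fin (nE G) → Set
Incident G v e = v ≡ proj₁ (ends G e) ⊎ v ≡ proj₂ (ends G e)

incident? : (G : Multigraph) → ∀ v e → Dec (Incident G v e)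
incident? G v e = (v Fin.≟ proj₁ (ends G e)) ⊎-dec (v Fin.≟ proj₂ (ends G e))

classSize : ∀ {m c} → (Fin m → Fin c) → Fin c → ℕ
classSize {m} col a = ∑[ e < m ] 𝟙 (col e Fin.≟ a)

module _ (G : Multigraph) {c : ℕ} (col : Fin (nE G) → Fin c) where

  colourDegree≡∑ : ∀ v a → colourDegree G col v a ≡ ∑[ e < nE G ] (𝟙 (incident? G v e) * 𝟙 (col e Fin.≟ a))
  colourDegree≡∑ v a = trans (length-filter-tabulate (λ e → incident? G v e ×-dec (col e Fin.≟ a)) {nE G} (λ e → e))
                             (sum-cong-≗ λ e → 𝟙-× (incident? G v e) (col e Fin.≟ a))

  ∑-incident : ∀ e → ∑[ v < nV G ] 𝟙 (incident? G v e) ≡ 2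
  ∑-incident e = begin
    ∑[ v < nV G ] 𝟙 (incident? G v e)                                  ≡⟨ sum-cong-≗ (λ v → 𝟙-⊎ (v Fin.≟ x) (v Fin.≟ y) λ v≡x v≡y → noLoop G e (trans (sym v≡x) v≡y)) ⟩
    ∑[ v < nV G ] (𝟙 (v Fin.≟ x) + 𝟙 (v Fin.≟ y))                      ≡⟨ ∑-distrib-+ (λ v → 𝟙 (v Fin.≟ x)) (λ v → 𝟙 (v Fin.≟ y)) ⟩
    ∑[ v < nV G ] 𝟙 (v Fin.≟ x) + ∑[ v < nV G ] 𝟙 (v Fin.≟ y)          ≡⟨ cong₂ _+_ (∑-𝟙-≟ x) (∑-𝟙-≟ y) ⟩
    2                                                                  ∎
    where
    open ≡-Reasoning
    x = proj₁ (ends G e)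
    y = proj₂ (ends G e)

  handshake : ∀ a → ∑[ v < nV G ] colourDegree G col v a ≡ 2 * classSize col a
  handshake a = begin
    ∑[ v < nV G ] colourDegree G col v a                   ≡⟨ sum-cong-≗ (λ v → colourDegree≡∑ v a) ⟩
    ∑[ v < nV G ] ∑[ e < nE G ] (𝟙 (incident? G v e) * χ e) ≡⟨ ∑-comm (λ v e → 𝟙 (incident? G v e) * χ e) ⟩
    ∑[ e < nE G ] ∑[ v < nV G ] (𝟙 (incident? G v e) * χ e) ≡⟨ sum-cong-≗ (λ e → *-distribʳ-sum (χ e) (λ v → 𝟙 (incident? G v e))) ⟨
    ∑[ e < nE G ] (∑[ v < nV G ] 𝟙 (incident? G v e) * χ e) ≡⟨ sum-cong-≗ (λ e → cong (_* χ e) (∑-incident e)) ⟩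
    ∑[ e < nE G ] (2 * χ e)                                ≡⟨ *-distribˡ-sum 2 χ ⟨
    2 * classSize col a                                    ∎
    where
    open ≡-Reasoning
    χ : Fin (nE G) → ℕ
    χ e = 𝟙 (col e Fin.≟ a)

  ∑-classSize : ∑[ a < c ] classSize col a ≡ nE G
  ∑-classSize = begin
    ∑[ a < c ] ∑[ e < nE G ] 𝟙 (col e Fin.≟ a)  ≡⟨ ∑-comm (λ a e → 𝟙 (col e Fin.≟ a)) ⟩
    ∑[ e < nE G ] ∑[ a < c ] 𝟙 (col e Fin.≟ a)  ≡⟨ sum-cong-≗ (λ e → trans (sum-cong-≗ (𝟙-≟-sym (col e))) (∑-𝟙-≟ (col e))) ⟩
    ∑[ e < nE G ] 1                             ≡⟨ ∑-const (nE G) 1 ⟩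
    nE G * 1                                    ≡⟨ *-identityʳ (nE G) ⟩
    nE G                                        ∎
    where open ≡-Reasoning

  module _ {d : ℕ} (defect : IsDefectColouring G d c col) where

    classSize≤nV*d/2 : ∀ a → classSize col a ≤ nV G * d / 2
    classSize≤nV*d/2 a = begin
      classSize col a          ≡⟨ m*n/n≡m (classSize col a) 2 ⟨
      classSize col a * 2 / 2  ≤⟨ /-monoˡ-≤ 2 twice≤ ⟩
      nV G * d / 2             ∎
      where
      open ≤-Reasoning
      twice≤ : classSize col a * 2 ≤ nV G * d
      twice≤ = begin
        classSize col a * 2                   ≡⟨ *-comm (classSize col a) 2 ⟩
        2 * classSize col a                   ≡⟨ handshake a ⟨
        ∑[ v < nV G ] colourDegree G col v a  ≤⟨ ∑-mono-≤ (λ v → defect v a) ⟩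
        ∑[ v < nV G ] d                       ≡⟨ ∑-const (nV G) d ⟩
        nV G * d                              ∎

    edges≤colours*[nV*d/2] : nE G ≤ c * (nV G * d / 2)
    edges≤colours*[nV*d/2] = begin
      nE G                          ≡⟨ ∑-classSize ⟨
      ∑[ a < c ] classSize col a    ≤⟨ ∑-mono-≤ classSize≤nV*d/2 ⟩
      ∑[ a < c ] (nV G * d / 2)     ≡⟨ ∑-const c _ ⟩
      c * (nV G * d / 2)            ∎
      where open ≤-Reasoning

avoids : Fin 3 → ℕ → ℕ
avoids ρ x = 𝟙 (¬? (x % 3 ≟ toℕ ρ))

avoids-periodic : ∀ ρ x → avoids ρ (3 + x) ≡ avoids ρ x
avoids-periodic ρ x = cong (λ r → 𝟙 (¬? (r ≟ toℕ ρ))) (trans (cong (_% 3) (+-comm 3 x)) ([m+n]%n≡m%n x 3))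

avoids-three-consecutive : ∀ ρ L → avoids ρ L + (avoids ρ (1 + L) + avoids ρ (2 + L)) ≡ 2
avoids-three-consecutive zero             zero    = refl
avoids-three-consecutive (suc zero)       zero    = refl
avoids-three-consecutive (suc (suc zero)) zero    = refl
avoids-three-consecutive ρ                (suc L) = begin
  avoids ρ (1 + L) + (avoids ρ (2 + L) + avoids ρ (3 + L))  ≡⟨ cong (λ z → avoids ρ (1 + L) + (avoids ρ (2 + L) + z)) (avoids-periodic ρ L) ⟩
  avoids ρ (1 + L) + (avoids ρ (2 + L) + avoids ρ L)        ≡⟨ x∙yz≈y∙zx (avoids ρ L) (avoids ρ (1 + L)) (avoids ρ (2 + L)) ⟨
  avoids ρ L + (avoids ρ (1 + L) + avoids ρ (2 + L))        ≡⟨ avoids-three-consecutive ρ L ⟩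
  2                                                         ∎
  where open ≡-Reasoning

window-avoids : ∀ ρ h L → ∑[ t < suc (h * 3) ] avoids ρ (toℕ t + L) ≤ suc (h * 2)
window-avoids ρ zero    L = ≤-trans (≤-reflexive (+-identityʳ _)) (𝟙≤1 (¬? (L % 3 ≟ toℕ ρ)))
window-avoids ρ (suc h) L = begin
  a₀ + (a₁ + (a₂ + ∑[ t < suc (h * 3) ] avoids ρ (3 + (toℕ t + L))))
    ≡⟨ trans (cong (a₀ +_) (sym (+-assoc a₁ a₂ _))) (sym (+-assoc a₀ (a₁ + a₂) _)) ⟩
  (a₀ + (a₁ + a₂)) + ∑[ t < suc (h * 3) ] avoids ρ (3 + (toℕ t + L))
    ≡⟨ cong₂ _+_ (avoids-three-consecutive ρ L) (sum-cong-≗ {suc (h * 3)} λ t → avoids-periodic ρ (toℕ t + L)) ⟩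
  2 + ∑[ t < suc (h * 3) ] avoids ρ (toℕ t + L)
    ≤⟨ +-monoʳ-≤ 2 (window-avoids ρ h L) ⟩
  suc (suc h * 2)
    ∎
  where
  open ≤-Reasoning
  a₀ = avoids ρ L
  a₁ = avoids ρ (1 + L)
  a₂ = avoids ρ (2 + L)

∑-quotient-fibre : ∀ {m} n (j : Fin m) (f : ℕ → ℕ) →
  ∑[ y < m * n ] (𝟙 (quotient n y Fin.≟ j) * f (toℕ y)) ≡ ∑[ t < n ] f (toℕ t + n * toℕ j)
∑-quotient-fibre {m} n j f = begin
  ∑[ y < m * n ] (𝟙 (quotient n y Fin.≟ j) * f (toℕ y))
    ≡⟨ ∑-combine m n _ ⟩
  ∑[ i < m ] ∑[ t < n ] (𝟙 (quotient n (combine i t) Fin.≟ j) * f (toℕ (combine i t)))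
    ≡⟨ sum-cong-≗ {m} (λ i → sum-cong-≗ {n} λ t → cong₂ (λ q y → 𝟙 (q Fin.≟ j) * f y)
                                                  (cong proj₁ (remQuot-combine i t))
                                                  (trans (toℕ-combine i t) (+-comm (n * toℕ i) (toℕ t)))) ⟩
  ∑[ i < m ] ∑[ t < n ] (𝟙 (i Fin.≟ j) * f (toℕ t + n * toℕ i))
    ≡⟨ sum-cong-≗ {m} (λ i → *-distribˡ-sum {n} (𝟙 (i Fin.≟ j)) (λ t → f (toℕ t + n * toℕ i))) ⟨
  ∑[ i < m ] (𝟙 (i Fin.≟ j) * ∑[ t < n ] f (toℕ t + n * toℕ i))
    ≡⟨ ∑-δ j (λ i → ∑[ t < n ] f (toℕ t + n * toℕ i)) ⟩
  ∑[ t < n ] f (toℕ t + n * toℕ j)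
    ∎
  where open ≡-Reasoning

windowColouring-isDefect : ∀ (G : Multigraph) {c h} (slot : Fin (nE G) → Fin (c * suc (h * 3))) →
  Injective _≡_ _≡_ slot → (ρ : Fin (nV G) → Fin 3) →
  (∀ v e → Incident G v e → toℕ (slot e) % 3 ≢ toℕ (ρ v)) →
  IsDefectColouring G (suc (h * 2)) c (quotient (suc (h * 3)) ∘ slot)
windowColouring-isDefect G {c} {h} slot slot-injective ρ avoid v j = begin
  colourDegree G col v j
    ≡⟨ colourDegree≡∑ G col v j ⟩
  ∑[ e < nE G ] (𝟙 (incident? G v e) * 𝟙 (col e Fin.≟ j))
    ≤⟨ ∑-mono-≤ (λ e → ≤-trans (*-monoˡ-≤ (𝟙 (col e Fin.≟ j)) (𝟙-mono (incident? G v e) (¬? (toℕ (slot e) % 3 ≟ toℕ (ρ v))) (avoid v e)))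
                                (≤-reflexive (*-comm (avoids (ρ v) (toℕ (slot e))) (𝟙 (col e Fin.≟ j))))) ⟩
  ∑[ e < nE G ] w (slot e)
    ≤⟨ ∑-injective-≤ slot slot-injective w ⟩
  ∑[ y < c * W ] w y
    ≡⟨ ∑-quotient-fibre W j (avoids (ρ v)) ⟩
  ∑[ t < W ] avoids (ρ v) (toℕ t + W * toℕ j)
    ≤⟨ window-avoids (ρ v) h _ ⟩
  suc (h * 2)
    ∎
  where
  open ≤-Reasoning
  W = suc (h * 3)
  col = quotient W ∘ slot
  w : Fin (c * W) → ℕ
  w y = 𝟙 (quotient W y Fin.≟ j) * avoids (ρ v) (toℕ y)

module Shannon (k : ℕ) where

  a b : ℕ
  a = ⌊ k /2⌋
  b = ⌈ k /2⌉

  Block : Set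
  Block = Fin a ⊎ (Fin a ⊎ Fin b)

  block : Fin (nE (Sh k)) → Block
  block e = map₂ (splitAt a) (splitAt a e)

  -- Slots ≡ 1, 2, 0 (mod 3) go to the pairs {0,1}, {1,2}, {0,2}; vertex v misses residue opposite v.
  code : Block → ℕ
  code (inj₁ i)        = 1 + toℕ i * 3
  code (inj₂ (inj₁ i)) = 2 + toℕ i * 3
  code (inj₂ (inj₂ i)) = 0 + toℕ i * 3

  slot : Fin (nE (Sh k)) → ℕ
  slot e = code (block e)

  opposite : Fin 3 → Fin 3
  opposite zero             = suc (suc zero)
  opposite (suc zero)       = zero
  opposite (suc (suc zero)) = suc zero

  slot-avoids-opposite : ∀ v e → Incident (Sh k) v e → slot e % 3 ≢ toℕ (opposite v)
  slot-avoids-opposite v e v∈e with splitAt a e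
  ... | inj₁ i rewrite residue 1 (toℕ i) = case v∈e of λ { (inj₁ refl) () ; (inj₂ refl) () }
  ... | inj₂ e′ with splitAt a e′
  ...   | inj₁ i rewrite residue 2 (toℕ i) = case v∈e of λ { (inj₁ refl) () ; (inj₂ refl) () }
  ...   | inj₂ i rewrite residue 0 (toℕ i) = case v∈e of λ { (inj₁ refl) () ; (inj₂ refl) () }

  code-injective : Injective _≡_ _≡_ code
  code-injective {inj₁ i}        {inj₁ j}        eq = cong inj₁ (r+toℕ*3-injective 1 eq)
  code-injective {inj₂ (inj₁ i)} {inj₂ (inj₁ j)} eq = cong (inj₂ ∘ inj₁) (r+toℕ*3-injective 2 eq)
  code-injective {inj₂ (inj₂ i)} {inj₂ (inj₂ j)} eq = cong (inj₂ ∘ inj₂) (r+toℕ*3-injective 0 eq)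
  code-injective {inj₁ i}        {inj₂ (inj₁ j)} eq = contradiction (residue-≡ 1 2 (toℕ i) (toℕ j) eq) λ ()
  code-injective {inj₁ i}        {inj₂ (inj₂ j)} eq = contradiction (residue-≡ 1 0 (toℕ i) (toℕ j) eq) λ ()
  code-injective {inj₂ (inj₁ i)} {inj₁ j}        eq = contradiction (residue-≡ 2 1 (toℕ i) (toℕ j) eq) λ ()
  code-injective {inj₂ (inj₁ i)} {inj₂ (inj₂ j)} eq = contradiction (residue-≡ 2 0 (toℕ i) (toℕ j) eq) λ ()
  code-injective {inj₂ (inj₂ i)} {inj₁ j}        eq = contradiction (residue-≡ 0 1 (toℕ i) (toℕ j) eq) λ ()
  code-injective {inj₂ (inj₂ i)} {inj₂ (inj₁ j)} eq = contradiction (residue-≡ 0 2 (toℕ i) (toℕ j) eq) λ ()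

  block-injective : Injective _≡_ _≡_ block
  block-injective {e} {e′} eq = trans (sym (unblock-block e)) (trans (cong unblock eq) (unblock-block e′))
    where
    unblock : Block → Fin (nE (Sh k))
    unblock = join a (a + b) ∘ map₂ (join a b)
    unblock-block : ∀ e → unblock (block e) ≡ e
    unblock-block e with splitAt a e | join-splitAt a (a + b) e
    ... | inj₁ _  | eq = eq
    ... | inj₂ e′ | eq = trans (cong (a ↑ʳ_) (join-splitAt a b e′)) eq

  slot-injective : Injective _≡_ _≡_ slot
  slot-injective = block-injective ∘ code-injective

  a≤b : a ≤ b
  a≤b = ⌊n/2⌋≤⌈n/2⌉ k

  b≤1+a : b ≤ suc a
  b≤1+a = ⌈n/2⌉≤1+⌊n/2⌋ k

  twice-nE≡ : 2 * nE (Sh k) ≡ 3 * a + 2 * b + a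
  twice-nE≡ = lemma a b
    where
    lemma : ∀ x y → 2 * (x + (x + y)) ≡ 3 * x + 2 * y + x
    lemma = solve-∀

  three-k≡ : 3 * k ≡ 3 * a + 2 * b + b
  three-k≡ = trans (cong (3 *_) (sym (⌊n/2⌋+⌈n/2⌉≡n k))) (lemma a b)
    where
    lemma : ∀ x y → 3 * (x + y) ≡ 3 * x + 2 * y + y
    lemma = solve-∀

  edges≤ : 2 * nE (Sh k) ≤ 3 * k
  edges≤ = begin
    2 * nE (Sh k)           ≡⟨ twice-nE≡ ⟩
    3 * a + 2 * b + a       ≤⟨ +-monoʳ-≤ (3 * a + 2 * b) a≤b ⟩
    3 * a + 2 * b + b       ≡⟨ three-k≡ ⟨
    3 * k                   ∎
    where open ≤-Reasoning

  edges≥ : 3 * k ∸ 1 ≤ 2 * nE (Sh k)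
  edges≥ = m≤n+o⇒m∸n≤o (3 * k) 1 (begin
    3 * k                   ≡⟨ three-k≡ ⟩
    3 * a + 2 * b + b       ≤⟨ +-monoʳ-≤ (3 * a + 2 * b) b≤1+a ⟩
    3 * a + 2 * b + suc a   ≡⟨ +-suc (3 * a + 2 * b) a ⟩
    suc (3 * a + 2 * b + a) ≡⟨ cong suc twice-nE≡ ⟨
    1 + 2 * nE (Sh k)       ∎)
    where open ≤-Reasoning

  thrice : ∀ n → n * 3 ≡ n + (n + n)
  thrice = solve-∀

  code< : ∀ x → code x < nE (Sh k)
  code< (inj₁ i)        = <-trans (n<1+n (1 + toℕ i * 3)) (code< (inj₂ (inj₁ i)))
  code< (inj₂ (inj₁ i)) = begin
    suc (toℕ i) * 3      ≤⟨ *-monoˡ-≤ 3 (toℕ<n i) ⟩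
    a * 3                ≡⟨ thrice a ⟩
    a + (a + a)          ≤⟨ +-monoʳ-≤ a (+-monoʳ-≤ a a≤b) ⟩
    a + (a + b)          ∎
    where open ≤-Reasoning
  code< (inj₂ (inj₂ i)) = +-cancelˡ-≤ 2 _ _ (begin
    suc (toℕ i) * 3      ≤⟨ *-monoˡ-≤ 3 (toℕ<n i) ⟩
    b * 3                ≡⟨ thrice b ⟩
    b + (b + b)          ≤⟨ +-mono-≤ b≤1+a (+-monoˡ-≤ b b≤1+a) ⟩
    suc a + (suc a + b)  ≡⟨ cong suc (+-suc a (a + b)) ⟩
    2 + (a + (a + b))    ∎)
    where open ≤-Reasoning

  module _ (h c : ℕ) where

    W : ℕ
    W = suc (h * 3)

    enough-colours⇒colourable : 3 * k ∸ 1 ≤ c * (W * 2) → HasDefectColouring (Sh k) (suc (h * 2)) c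
    enough-colours⇒colourable enough =
      quotient W ∘ slotᶠ , windowColouring-isDefect (Sh k) {c} {h} slotᶠ slotᶠ-injective opposite avoids-opposite
      where
      nE≤ : nE (Sh k) ≤ c * W
      nE≤ = m*2≤1+n*2⇒m≤n (begin
        nE (Sh k) * 2        ≡⟨ *-comm (nE (Sh k)) 2 ⟩
        2 * nE (Sh k)        ≤⟨ edges≤ ⟩
        3 * k                ≤⟨ m≤n+m∸n (3 * k) 1 ⟩
        1 + (3 * k ∸ 1)      ≤⟨ +-monoʳ-≤ 1 enough ⟩
        1 + c * (W * 2)      ≡⟨ cong (1 +_) (*-assoc c W 2) ⟨
        1 + c * W * 2        ∎)
        where open ≤-Reasoning
      slotᶠ : Fin (nE (Sh k)) → Fin (c * W)
      slotᶠ e = fromℕ< (<-≤-trans (code< (block e)) nE≤)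
      slotᶠ-injective : Injective _≡_ _≡_ slotᶠ
      slotᶠ-injective {e} {e′} eq = slot-injective (fromℕ<-injective (slot e) (slot e′) _ _ eq)
      avoids-opposite : ∀ v e → Incident (Sh k) v e → toℕ (slotᶠ e) % 3 ≢ toℕ (opposite v)
      avoids-opposite v e v∈e rewrite toℕ-fromℕ< (<-≤-trans (code< (block e)) nE≤) = slot-avoids-opposite v e v∈e

    colourable⇒enough-colours : HasDefectColouring (Sh k) (suc (h * 2)) c → 3 * k ∸ 1 ≤ c * (W * 2)
    colourable⇒enough-colours (col , defect) = begin
      3 * k ∸ 1                          ≤⟨ edges≥ ⟩
      2 * nE (Sh k)                      ≤⟨ *-monoʳ-≤ 2 (edges≤colours*[nV*d/2] (Sh k) col defect) ⟩
      2 * (c * (3 * suc (h * 2) / 2))    ≡⟨ cong (λ w → 2 * (c * w)) (trans (/-congˡ {o = 2} (3*[1+h*2]≡1+[1+h*3]*2 h)) ([1+n*2]/2≡n W)) ⟩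
      2 * (c * W)                        ≡⟨ *-comm 2 (c * W) ⟩
      c * W * 2                          ≡⟨ *-assoc c W 2 ⟩
      c * (W * 2)                        ∎
      where open ≤-Reasoning

χ′-Sh : ∀ k h → ChiD≡ (Sh k) (suc (h * 2)) ⌈ 3 * k ∸ 1 / suc (h * 3) * 2 ⌉
χ′-Sh k h = enough-colours⇒colourable h c₀ (≤⌈/⌉* (3 * k ∸ 1) _)
          , λ c colouring → ⌈/⌉-least (3 * k ∸ 1) _ c (colourable⇒enough-colours h c colouring)
  where
  open Shannon k
  c₀ = ⌈ 3 * k ∸ 1 / suc (h * 3) * 2 ⌉

lemma8 : (k d : ℕ) → 1 ≤ k → 1 ≤ d → d % 2 ≡ 1 →
    ChiD≡ (Sh k) d ⌈ 3 * k ∸ 1 / 3 * d ∸ 1 ⌉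
lemma8 k d _ _ d-odd = subst (λ d → ChiD≡ (Sh k) d ⌈ 3 * k ∸ 1 / 3 * d ∸ 1 ⌉) (sym d≡) χ′
  where
  h = d / 2
  d≡ : d ≡ suc (h * 2)
  d≡ = trans (m≡m%n+[m/n]*n d 2) (cong (_+ h * 2) d-odd)
  χ′ : ChiD≡ (Sh k) (suc (h * 2)) ⌈ 3 * k ∸ 1 / 3 * suc (h * 2) ∸ 1 ⌉
  χ′ = subst (λ D → ChiD≡ (Sh k) (suc (h * 2)) ⌈ 3 * k ∸ 1 / D ∸ 1 ⌉) (sym (3*[1+h*2]≡1+[1+h*3]*2 h)) (χ′-Sh k h)
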